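{- Let $\alpha=(a_1,\dots,a_n)\in PP_n$ and $k\ge1$. Then the following are equivalent: (i) every maximal interval $[p,q]\subseteq U_\alpha$ satisfies $|[p,q]|\le k$; (ii) for every permutation $\sigma$ of $[n]$, the rearrangement $(a_{\sigma(1)},\dots,a_{\sigma(n)})$ belongs to $PF_{n,k}$ (in particular $\alpha\in PF_{n,k}$).
   Context: $[n]=\{1,\dots,n\}$, $PP_n=[n]^n$. Cars arrive in order at a one-way street with spots $1,\dots,n$; car $c_i$ has preference $a_i$. Under the $k$-Naples parking rule, car $c_i$ drives to spot $a_i$ and parks there if free; otherwise it checks spots $a_i-1,\dots,a_i-k$ (only those $\ge1$) in order and parks in the first free one; otherwise it drives forward to the first free spot $j>a_i$, failing if none. $PF_{n,k}$: preferences for which all cars park. $|\alpha|_i=|\{j:a_j=i\}|$, $u_\alpha(j)=\sum_{i=j}^n|\alpha|_i-(n-j+1)$, $U_\alpha=\{j\in[n]:u_\alpha(j)\ge1\}$. A maximal interval of a finite set $A\subseteq\mathbb N$ is an interval in $A$ not strictly contained in another interval in $A$. -}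

module Defs where

open import Data.Nat using (ℕ; zero; suc; _+_; _∸_; _≤_; _<_; _<ᵇ_; _≡ᵇ_)
open import Data.Nat.Properties using (_≟_)
open import Data.Integer as ℤ using (ℤ; +_; _-_)
open import Data.Bool using (Bool; true; false; not; if_then_else_)
open import Data.Fin using (Fin)
open import Data.List using (List; []; _∷_; _++_; map; filter; length; tabulate; upTo)
open import Data.Nat.ListAction using () renaming (sum to lsum)
open import Data.Bool.ListAction using (any)
open import Data.Maybe using (Maybe; just; nothing)
open import Data.Product using (_×_)
open import Relation.Binary.PropositionalEquality using (_≡_)

-- A preference list of length n is a function  Fin n → ℕ  (car c_{i+1} has
-- preference α i).  α ∈ PP_n means every value lies in [n] = {1,…,n}.
InPP : (n : ℕ) → (Fin n → ℕ) → Set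
InPP n α = (i : Fin n) → 1 ≤ α i × α i ≤ n

isFree : List ℕ → ℕ → Bool
isFree occ j = not (any (λ x → x ≡ᵇ j) occ)

-- spots a-1, a-2, …, a-k, keeping only those ≥ 1
backSpots : ℕ → ℕ → List ℕ
backSpots a k = map (λ i → a ∸ suc i) (filter (λ i → suc i Data.Nat.<? a) (upTo k))
  where open import Data.Nat using (_<?_)

forwardSpots : ℕ → ℕ → List ℕ
forwardSpots n a = map (λ i → a + suc i) (upTo (n ∸ a))

firstFree : List ℕ → List ℕ → Maybe ℕ
firstFree occ [] = nothing
firstFree occ (j ∷ js) = if isFree occ j then just j else firstFree occ js

-- where a car with preference a parks (nothing = it fails to park)
-- on a street with spots 1..n under the k-Naples rule, given occupied spots
parkSpot : ℕ → ℕ → List ℕ → ℕ → Maybe ℕ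
parkSpot n k occ a = firstFree occ (a ∷ (backSpots a k ++ forwardSpots n a))

runAll : ℕ → ℕ → List ℕ → List ℕ → Bool
runAll n k occ [] = true
runAll n k occ (a ∷ as) with parkSpot n k occ a
... | nothing = false
... | just j  = runAll n k (j ∷ occ) as

InPF : (n k : ℕ) → (Fin n → ℕ) → Set
InPF n k α = runAll n k [] (tabulate α) ≡ true

mult : (n : ℕ) → (Fin n → ℕ) → ℕ → ℕ
mult n α i = length (filter (λ a → a ≟ i) (tabulate α))

tailSum : (n : ℕ) → (Fin n → ℕ) → ℕ → ℕ
tailSum n α j = lsum (map (λ t → mult n α (j + t)) (upTo (suc n ∸ j)))

u : (n : ℕ) → (Fin n → ℕ) → ℕ → ℤ
u n α j = + tailSum n α j - + (suc n ∸ j)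

InU : (n : ℕ) → (Fin n → ℕ) → ℕ → Set
InU n α j = (1 ≤ j × j ≤ n) × (ℤ.+ 1 ℤ.≤ u n α j)

IsIntervalIn : (ℕ → Set) → ℕ → ℕ → Set
IsIntervalIn A p q = p ≤ q × ((j : ℕ) → p ≤ j → j ≤ q → A j)

IsMaximalIntervalIn : (ℕ → Set) → ℕ → ℕ → Set
IsMaximalIntervalIn A p q =
  IsIntervalIn A p q ×
  ((p' q' : ℕ) → IsIntervalIn A p' q' → p' ≤ p → q ≤ q' → (p' ≡ p × q' ≡ q))

intervalSize : ℕ → ℕ → ℕ
intervalSize p q = suc q ∸ p

-- Write c(j) for the number of cars preferring a spot ≥ j, so that j ∈ U_α says
-- c(j) > n − j + 1: the spots j, …, n cannot hold all of these cars.
--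
-- If some arrangement jams, let f be the largest free spot when a car gets stuck.
-- That car prefers a spot beyond f + k, and a car parked above f whose preference
-- lies below some j ≤ f + k + 1 would have backed into f. As every spot above f
-- is taken, each j in [f + 1, f + k + 1] lies in U_α: k + 1 consecutive elements.
--
-- Conversely, let [p, q] be a maximal interval of U_α with more than k elements,
-- and let the cars preferring a spot ≥ p go first, in increasing order. Since
-- p − 1 ∉ U_α while p, …, p + k ∈ U_α, each of them finds a free spot between p
-- and its preference within its backward range, so all of them park in [p, n],
-- which has too few spots.

module Submission where

open import Data.Bool using (true; false; T)
open import Data.Empty using (⊥; ⊥-elim)
open import Data.Fin as Fin using (Fin; cast)
import Data.Fin.Properties as Finₚ
open import Data.Fin.Permutation using (Permutation′; _⟨$⟩ʳ_; _∘ₚ_; cast-id)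
import Data.Integer as ℤ
import Data.Integer.Properties as ℤₚ
open import Data.List using (List; []; _∷_; [_]; _++_; map; filter; length; lookup; upTo; applyUpTo; tabulate)
open import Data.List.Properties
  using ( length-map; length-upTo; length-++; length-filter; length-tabulate; lookup-tabulate
        ; filter-++; filter-accept; filter-reject; filter-all; filter-none; map-upTo; applyUpTo-∷ʳ )
open import Data.List.Membership.Propositional using (_∈_; _∉_; find)
open import Data.List.Membership.Propositional.Properties
  using (∈-map⁻; ∈-map⁺; ∈-filter⁻; ∈-filter⁺; ∈-upTo⁻; ∈-upTo⁺; ∈-++⁻; ∈-++⁺ˡ; ∈-++⁺ʳ; ∈-∃++)
open import Data.List.Relation.Binary.Permutation.Propositional using (_↭_; ↭-refl; ↭-sym; ↭-trans; ↭⇒↭ₛ)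
open import Data.List.Relation.Binary.Permutation.Propositional.Properties using (↭-length; filter-↭; shift)
open import Data.List.Relation.Binary.Permutation.Setoid using (onIndices)
open import Data.List.Relation.Binary.Permutation.Setoid.Properties using (onIndices-lookup)
open import Data.List.Relation.Binary.Subset.Propositional using (_⊆_)
open import Data.List.Relation.Unary.All as All using (All; []; _∷_)
import Data.List.Relation.Unary.All.Properties as Allₚ
open import Data.List.Relation.Unary.AllPairs as AllPairs using (AllPairs; []; _∷_)
import Data.List.Relation.Unary.AllPairs.Properties as AllPairsₚ
open import Data.List.Relation.Unary.Any using (here; there)
open import Data.List.Relation.Unary.Sorted.TotalOrder.Properties using (lookup-mono-≤)
open import Data.List.Relation.Unary.Unique.Propositional using (Unique)
open import Data.Maybe using (just; nothing; _<∣>_)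
open import Data.Nat
open import Data.Nat.ListAction using () renaming (sum to lsum)
open import Data.Nat.ListAction.Properties using (sum-++)
open import Data.Nat.Properties
open import Data.Product using (∃; ∃₂; _×_; _,_; proj₁; proj₂)
open import Data.Sum using (_⊎_; inj₁; inj₂; [_,_]′)
open import Function using (_∘_; case_of_)
open import Function.Bundles using (_⇔_; mk⇔; Equivalence)
open import Relation.Binary.Definitions using (tri<; tri≈; tri>)
open import Relation.Binary.PropositionalEquality
  using (_≡_; refl; sym; trans; cong; cong₂; subst; subst₂; setoid; module ≡-Reasoning)
open import Relation.Nullary using (¬_; yes; no)
open import Relation.Nullary.Decidable using (decidable-stable; _×-dec_)
open import Relation.Unary using (Decidable)

open import Algebra.Properties.CommutativeMonoid.Sum +-0-commutativeMonoid using (sum; sum-permute)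
open import Data.List.Membership.DecPropositional _≟_ using (_∈?_)
open import Data.List.Sort ≤-decTotalOrder using (sort; sort-↭; sort-↗)

open import Defs

unique-⊆⇒length≤ : ∀ {a} {A : Set a} {xs ys : List A} → Unique xs → xs ⊆ ys → length xs ≤ length ys
unique-⊆⇒length≤ {xs = []} _ _ = z≤n
unique-⊆⇒length≤ {xs = x ∷ xs} (x∉xs ∷ unique) xs⊆ys with ∈-∃++ (xs⊆ys (here refl))
... | us , vs , refl = begin
  suc (length xs)               ≤⟨ s≤s (unique-⊆⇒length≤ unique xs⊆us++vs) ⟩
  suc (length (us ++ vs))       ≡⟨ cong suc (length-++ us) ⟩
  suc (length us + length vs)   ≡⟨ sym (+-suc (length us) (length vs)) ⟩
  length us + length (x ∷ vs)   ≡⟨ sym (length-++ us) ⟩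
  length (us ++ x ∷ vs)         ∎
  where
  open ≤-Reasoning
  xs⊆us++vs : ∀ {y} → y ∈ xs → y ∈ us ++ vs
  xs⊆us++vs {y} y∈xs with ∈-++⁻ us (xs⊆ys (there y∈xs))
  ... | inj₁ y∈us = ∈-++⁺ˡ y∈us
  ... | inj₂ (here refl) = ⊥-elim (All.lookup x∉xs y∈xs refl)
  ... | inj₂ (there y∈vs) = ∈-++⁺ʳ us y∈vs

∸-split : ∀ {m n o} → m ≤ n → n ≤ o → o ∸ m ≡ (o ∸ n) + (n ∸ m)
∸-split {m} {n} {o} m≤n n≤o = begin
  o ∸ m                ≡⟨ cong (_∸ m) (sym (m∸n+n≡m n≤o)) ⟩
  (o ∸ n) + n ∸ m      ≡⟨ +-∸-assoc (o ∸ n) m≤n ⟩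
  (o ∸ n) + (n ∸ m)    ∎
  where open ≡-Reasoning

module _ {P : ℕ → Set} (P? : Decidable P) where

  lastCounterexample : ∀ m → (∀ {x} → 1 ≤ x → x ≤ m → P x) ⊎
    ∃ λ f → 1 ≤ f × f ≤ m × ¬ P f × (∀ {x} → f < x → x ≤ m → P x)
  lastCounterexample zero = inj₁ λ 1≤x x≤0 → ⊥-elim (<⇒≱ 1≤x x≤0)
  lastCounterexample (suc m) with P? (suc m)
  ... | no ¬P = inj₂ (suc m , s≤s z≤n , ≤-refl , ¬P , λ m<x x≤m → ⊥-elim (<⇒≱ m<x x≤m))
  ... | yes P1+m with lastCounterexample m
  ...   | inj₁ all = inj₁ λ 1≤x x≤1+m → [ all 1≤x ∘ s≤s⁻¹ , (λ { refl → P1+m }) ]′ (m≤n⇒m<n∨m≡n x≤1+m)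
  ...   | inj₂ (f , 1≤f , f≤m , ¬Pf , above) = inj₂ (f , 1≤f , m≤n⇒m≤1+n f≤m , ¬Pf ,
    λ f<x x≤1+m → [ above f<x ∘ s≤s⁻¹ , (λ { refl → P1+m }) ]′ (m≤n⇒m<n∨m≡n x≤1+m))

module _ {A : ℕ → Set} where

  interval-singleton : ∀ {p} → A p → IsIntervalIn A p p
  interval-singleton Ap = ≤-refl , λ j p≤j j≤p → subst A (≤-antisym p≤j j≤p) Ap

  interval-join : ∀ {p q r s} → IsIntervalIn A p q → IsIntervalIn A r s → r ≤ suc q → q ≤ s →
    IsIntervalIn A p s
  interval-join {p} {q} {r} {s} (p≤q , inside₁) (_ , inside₂) r≤1+q q≤s = ≤-trans p≤q q≤s , inside
    where
    inside : ∀ j → p ≤ j → j ≤ s → A j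
    inside j p≤j j≤s with j ≤? q
    ... | yes j≤q = inside₁ j p≤j j≤q
    ... | no j≰q = inside₂ j (≤-trans r≤1+q (≰⇒> j≰q)) j≤s

  maximal⇒¬below : ∀ {p q} → IsMaximalIntervalIn A (suc p) q → ¬ A p
  maximal⇒¬below {p} {q} (interval , maximal) Ap = 1+n≢n (sym (proj₁ (maximal p q longer (n≤1+n p) ≤-refl)))
    where
    longer : IsIntervalIn A p q
    longer = interval-join (interval-singleton Ap) interval ≤-refl (≤-trans (n≤1+n p) (proj₁ interval))

  bordered⇒maximal : ∀ {p q} → IsIntervalIn A (suc p) q → ¬ A p → ¬ A (suc q) →
    IsMaximalIntervalIn A (suc p) q
  bordered⇒maximal {p} {q} (1+p≤q , inside) ¬Ap ¬A1+q = (1+p≤q , inside) , maximal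
    where
    maximal : ∀ p' q' → IsIntervalIn A p' q' → p' ≤ suc p → q ≤ q' → p' ≡ suc p × q' ≡ q
    maximal p' q' (_ , inside') p'≤1+p q≤q' = ≤-antisym p'≤1+p 1+p≤p' , ≤-antisym q'≤q q≤q'
      where
      1+p≤p' : suc p ≤ p'
      1+p≤p' = ≮⇒≥ λ p'<1+p → ¬Ap (inside' p (s≤s⁻¹ p'<1+p) (≤-trans (n≤1+n p) (≤-trans 1+p≤q q≤q')))
      q'≤q : q' ≤ q
      q'≤q = ≮⇒≥ λ q<q' → ¬A1+q (inside' (suc q) (≤-trans p'≤1+p (≤-trans 1+p≤q (n≤1+n q))) q<q')

  module _ (A? : Decidable A) where

    upperBorder : ∀ d {q} → A q → (∀ {j} → A j → j ≤ q + d) → ∃ λ q' → IsIntervalIn A q q' × ¬ A (suc q')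
    upperBorder d {q} Aq bounded with A? (suc q)
    ... | no ¬A1+q = q , interval-singleton Aq , ¬A1+q
    upperBorder zero {q} Aq bounded | yes A1+q =
      ⊥-elim (1+n≰n (≤-trans (bounded A1+q) (≤-reflexive (+-identityʳ q))))
    upperBorder (suc d) {q} Aq bounded | yes A1+q
      with q' , interval , ¬A1+q' ← upperBorder d A1+q (λ {j} Aj → subst (j ≤_) (+-suc q d) (bounded Aj)) =
      q' , interval-join (interval-singleton Aq) interval ≤-refl (≤-trans (n≤1+n q) (proj₁ interval)) , ¬A1+q'

    lowerBorder : ¬ A 0 → ∀ {p} → A p → ∃ λ p₀ → IsIntervalIn A (suc p₀) p × ¬ A p₀
    lowerBorder ¬A0 {zero} A0 = ⊥-elim (¬A0 A0)
    lowerBorder ¬A0 {suc p} A1+p with A? p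
    ... | no ¬Ap = p , interval-singleton A1+p , ¬Ap
    ... | yes Ap with p₀ , interval , ¬Ap₀ ← lowerBorder ¬A0 Ap =
      p₀ , interval-join interval (interval-singleton A1+p) ≤-refl (n≤1+n p) , ¬Ap₀

    extendToMaximal : ¬ A 0 → ∀ {N} → (∀ {j} → A j → j ≤ N) → ∀ {p q} → IsIntervalIn A p q →
      ∃₂ λ p' q' → IsMaximalIntervalIn A p' q' × intervalSize p q ≤ intervalSize p' q'
    extendToMaximal ¬A0 {N} bounded {p} {q} interval@(p≤q , inside)
      with p₀ , below , ¬Ap₀ ← lowerBorder ¬A0 (inside p ≤-refl p≤q)
         | q' , above , ¬A1+q' ← upperBorder N (inside q p≤q ≤-refl) (λ Aj → ≤-trans (bounded Aj) (m≤n+m N q)) =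
      suc p₀ , q' , bordered⇒maximal extended ¬Ap₀ ¬A1+q' , ∸-mono (s≤s (proj₁ above)) (proj₁ below)
      where
      extended = interval-join (interval-join below interval (n≤1+n p) p≤q) above (n≤1+n q) (proj₁ above)

sortingPermutation : ∀ {n} (g : Fin n → ℕ) →
  ∃ λ (σ : Permutation′ n) → ∀ {i j} → i Fin.≤ j → g (σ ⟨$⟩ʳ i) ≤ g (σ ⟨$⟩ʳ j)
sortingPermutation {n} g = σ , monotone
  where
  sorted = sort (tabulate g)
  sorted↭ = ↭⇒↭ₛ (sort-↭ (tabulate g))
  |tabulate|≡n = length-tabulate g
  n≡|sorted| = sym (trans (↭-length (sort-↭ (tabulate g))) |tabulate|≡n)
  σ : Permutation′ n
  σ = cast-id n≡|sorted| ∘ₚ (onIndices sorted↭ ∘ₚ cast-id |tabulate|≡n)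
  σ-sorts : ∀ i → g (σ ⟨$⟩ʳ i) ≡ lookup sorted (cast n≡|sorted| i)
  σ-sorts i = begin
    g (σ ⟨$⟩ʳ i)
      ≡⟨ sym (lookup-tabulate g (σ ⟨$⟩ʳ i)) ⟩
    lookup (tabulate g) (cast (sym |tabulate|≡n) (σ ⟨$⟩ʳ i))
      ≡⟨ cong (lookup (tabulate g)) (Finₚ.cast-involutive (sym |tabulate|≡n) |tabulate|≡n _) ⟩
    lookup (tabulate g) (onIndices sorted↭ ⟨$⟩ʳ cast n≡|sorted| i)
      ≡⟨ sym (onIndices-lookup (setoid ℕ) sorted↭ (cast n≡|sorted| i)) ⟩
    lookup sorted (cast n≡|sorted| i) ∎
    where open ≡-Reasoning
  monotone : ∀ {i j} → i Fin.≤ j → g (σ ⟨$⟩ʳ i) ≤ g (σ ⟨$⟩ʳ j)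
  monotone {i} {j} i≤j = subst₂ _≤_ (sym (σ-sorts i)) (sym (σ-sorts j))
    (lookup-mono-≤ ≤-totalOrder (sort-↗ (tabulate g))
      (subst₂ _≤_ (sym (Finₚ.toℕ-cast n≡|sorted| i)) (sym (Finₚ.toℕ-cast n≡|sorted| j)) i≤j))

-- Where a car parks

isFree-true⇒∉ : ∀ {occ x} → isFree occ x ≡ true → x ∉ occ
isFree-true⇒∉ {y ∷ occ} {x} free x∈ with y ≡ᵇ x in y≡ᵇx | x∈
... | false | here refl = subst T y≡ᵇx (≡⇒≡ᵇ x x refl)
... | false | there x∈occ = isFree-true⇒∉ free x∈occ

isFree-false⇒∈ : ∀ {occ x} → isFree occ x ≡ false → x ∈ occ
isFree-false⇒∈ {y ∷ occ} {x} occupied with y ≡ᵇ x in y≡ᵇx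
... | true = here (sym (≡ᵇ⇒≡ y x (subst T (sym y≡ᵇx) _)))
... | false = there (isFree-false⇒∈ occupied)

firstFree-just : ∀ occ xs {s} → firstFree occ xs ≡ just s → s ∈ xs × s ∉ occ
firstFree-just occ (x ∷ xs) eq with isFree occ x in free
firstFree-just occ (x ∷ xs) refl | true = here refl , isFree-true⇒∉ free
... | false = let s∈xs , s∉occ = firstFree-just occ xs eq in there s∈xs , s∉occ

firstFree-nothing : ∀ occ xs → firstFree occ xs ≡ nothing → All (_∈ occ) xs
firstFree-nothing occ [] _ = []
firstFree-nothing occ (x ∷ xs) eq with isFree occ x in free
... | false = isFree-false⇒∈ free ∷ firstFree-nothing occ xs eq

firstFree-++ : ∀ occ xs ys → firstFree occ (xs ++ ys) ≡ (firstFree occ xs <∣> firstFree occ ys)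
firstFree-++ occ [] ys = refl
firstFree-++ occ (x ∷ xs) ys with isFree occ x
... | true = refl
... | false = firstFree-++ occ xs ys

firstFree-first : ∀ {R : ℕ → ℕ → Set} occ {xs s x} → AllPairs R xs →
  firstFree occ xs ≡ just s → x ∈ xs → x ∉ occ → x ≡ s ⊎ R s x
firstFree-first occ {x ∷ xs} (R-x ∷ ordered) eq x'∈ x'∉occ with isFree occ x in free | x'∈
firstFree-first occ {x ∷ xs} (R-x ∷ ordered) refl x'∈ x'∉occ | true | here refl = inj₁ refl
firstFree-first occ {x ∷ xs} (R-x ∷ ordered) refl x'∈ x'∉occ | true | there x'∈xs = inj₂ (All.lookup R-x x'∈xs)
... | false | here refl = ⊥-elim (x'∉occ (isFree-false⇒∈ free))
... | false | there x'∈xs = firstFree-first occ ordered eq x'∈xs x'∉occ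

upTo-ascending : ∀ m → AllPairs _<_ (upTo m)
upTo-ascending m = AllPairsₚ.applyUpTo⁺₁ (λ i → i) m (λ i<j _ → i<j)

∈-backSpots⁻ : ∀ {a k x} → x ∈ backSpots a k → 1 ≤ x × a ∸ k ≤ x × x < a
∈-backSpots⁻ {a} {k} x∈ with ∈-map⁻ (λ i → a ∸ suc i) x∈
... | i , i∈ , refl with ∈-filter⁻ (λ i → suc i <? a) {xs = upTo k} i∈
... | i∈upTo , 1+i<a = m<n⇒0<n∸m 1+i<a , ∸-monoʳ-≤ a (∈-upTo⁻ i∈upTo) , ∸-monoʳ-< z<s (<⇒≤ 1+i<a)

∈-backSpots⁺ : ∀ {a k x} → 1 ≤ x → a ∸ k ≤ x → x < a → x ∈ backSpots a k
∈-backSpots⁺ {a} {k} {x} 1≤x a∸k≤x x<a =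
  subst (_∈ backSpots a k) a∸[1+d]≡x
    (∈-map⁺ (λ i → a ∸ suc i) (∈-filter⁺ (λ i → suc i <? a) (∈-upTo⁺ {n = k} 1+d≤k) 1+d<a))
  where
  d = a ∸ suc x
  a≡x+[1+d] : a ≡ x + suc d
  a≡x+[1+d] = trans (sym (m+[n∸m]≡n x<a)) (sym (+-suc x d))
  a∸[1+d]≡x : a ∸ suc d ≡ x
  a∸[1+d]≡x = trans (cong (_∸ suc d) a≡x+[1+d]) (m+n∸n≡m x (suc d))
  1+d<a : suc d < a
  1+d<a = subst (suc d <_) (sym (trans a≡x+[1+d] (+-comm x (suc d)))) (m<m+n (suc d) 1≤x)
  1+d≤k : suc d ≤ k
  1+d≤k = +-cancelˡ-≤ x (suc d) k (begin
    x + suc d   ≡⟨ sym a≡x+[1+d] ⟩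
    a           ≤⟨ m≤n+m∸n a k ⟩
    k + (a ∸ k) ≤⟨ +-monoʳ-≤ k a∸k≤x ⟩
    k + x       ≡⟨ +-comm k x ⟩
    x + k       ∎)
    where open ≤-Reasoning

backSpots-descending : ∀ a k → AllPairs (λ u v → v ≤ u) (a ∷ backSpots a k)
backSpots-descending a k =
  All.tabulate (λ x∈ → <⇒≤ (proj₂ (proj₂ (∈-backSpots⁻ {a} {k} x∈))))
  ∷ AllPairsₚ.map⁺ (AllPairsₚ.filter⁺ (λ i → suc i <? a)
      (AllPairs.map (λ i<j → ∸-monoʳ-≤ a (s≤s (<⇒≤ i<j))) (upTo-ascending k)))

∈-forwardSpots⁻ : ∀ {n a x} → x ∈ forwardSpots n a → a < x × x ≤ n
∈-forwardSpots⁻ {n} {a} x∈ with ∈-map⁻ (λ i → a + suc i) x∈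
... | i , i∈ , refl = m<m+n a z<s , subst (_≤ n) (+-comm (suc i) a) (m≤o∸n⇒m+n≤o (suc i) a≤n i<n∸a)
  where
  i<n∸a = ∈-upTo⁻ i∈
  a≤n = <⇒≤ (m∸n≢0⇒n<m (λ n∸a≡0 → n≮0 (subst (i <_) n∸a≡0 i<n∸a)))

∈-forwardSpots⁺ : ∀ {n a x} → a < x → x ≤ n → x ∈ forwardSpots n a
∈-forwardSpots⁺ {n} {a} {x} a<x x≤n =
  subst (_∈ forwardSpots n a) a+[1+d]≡x (∈-map⁺ (λ i → a + suc i) (∈-upTo⁺ d<n∸a))
  where
  d = x ∸ suc a
  a+[1+d]≡x : a + suc d ≡ x
  a+[1+d]≡x = trans (+-suc a d) (m+[n∸m]≡n a<x)
  d<n∸a : d < n ∸ a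
  d<n∸a = m+n≤o⇒m≤o∸n (suc d) (subst (_≤ n) (trans (sym a+[1+d]≡x) (+-comm a (suc d))) x≤n)

forwardSpots-ascending : ∀ n a → AllPairs _<_ (forwardSpots n a)
forwardSpots-ascending n a =
  AllPairsₚ.map⁺ (AllPairs.map (λ i<j → +-monoʳ-< a (s<s i<j)) (upTo-ascending (n ∸ a)))

forwardSpots-unique : ∀ n a → Unique (forwardSpots n a)
forwardSpots-unique n a = AllPairs.map <⇒≢ (forwardSpots-ascending n a)

length-forwardSpots : ∀ n a → length (forwardSpots n a) ≡ n ∸ a
length-forwardSpots n a = trans (length-map (λ i → a + suc i) (upTo (n ∸ a))) (length-upTo (n ∸ a))

∈-backward⁺ : ∀ {a k x} → 1 ≤ x → a ∸ k ≤ x → x ≤ a → x ∈ a ∷ backSpots a k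
∈-backward⁺ {a} {k} 1≤x a∸k≤x x≤a with m≤n⇒m<n∨m≡n x≤a
... | inj₁ x<a = there (∈-backSpots⁺ {a} {k} 1≤x a∸k≤x x<a)
... | inj₂ refl = here refl

∈-backward⁻ : ∀ {a k x} → x ∈ a ∷ backSpots a k → a ∸ k ≤ x × x ≤ a
∈-backward⁻ {a} {k} (here refl) = m∸n≤m a k , ≤-refl
∈-backward⁻ {a} {k} (there x∈) = let _ , a∸k≤x , x<a = ∈-backSpots⁻ {a} {k} x∈ in a∸k≤x , <⇒≤ x<a

parkSpot-split : ∀ n k occ a →
  parkSpot n k occ a ≡ (firstFree occ (a ∷ backSpots a k) <∣> firstFree occ (forwardSpots n a))
parkSpot-split n k occ a = firstFree-++ occ (a ∷ backSpots a k) (forwardSpots n a)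

parkSpot-free : ∀ {n k occ a s} → parkSpot n k occ a ≡ just s → s ∉ occ
parkSpot-free {n} {k} {occ} {a} parked = proj₂ (firstFree-just occ (a ∷ backSpots a k ++ forwardSpots n a) parked)

parkSpot-range : ∀ {n k occ a s} → parkSpot n k occ a ≡ just s → a ≤ n → a ∸ k ≤ s × s ≤ n
parkSpot-range {n} {k} {occ} {a} parked a≤n
  with ∈-++⁻ (a ∷ backSpots a k) (proj₁ (firstFree-just occ (a ∷ backSpots a k ++ forwardSpots n a) parked))
... | inj₁ s∈ = let a∸k≤s , s≤a = ∈-backward⁻ {a} {k} s∈ in a∸k≤s , ≤-trans s≤a a≤n
... | inj₂ s∈ = let a<s , s≤n = ∈-forwardSpots⁻ {n} {a} s∈ in ≤-trans (m∸n≤m a k) (<⇒≤ a<s) , s≤n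

parkSpot-nothing : ∀ {n k occ a x} → parkSpot n k occ a ≡ nothing →
  1 ≤ x → a ∸ k ≤ x → x ≤ n → x ∈ occ
parkSpot-nothing {n} {k} {occ} {a} {x} stuck 1≤x a∸k≤x x≤n =
  All.lookup (firstFree-nothing occ (a ∷ backSpots a k ++ forwardSpots n a) stuck) x∈
  where
  x∈ : x ∈ a ∷ backSpots a k ++ forwardSpots n a
  x∈ with x ≤? a
  ... | yes x≤a = ∈-++⁺ˡ (∈-backward⁺ {a} {k} 1≤x a∸k≤x x≤a)
  ... | no x≰a = ∈-++⁺ʳ (a ∷ backSpots a k) (∈-forwardSpots⁺ {n} {a} (≰⇒> x≰a) x≤n)

parkSpot-backward : ∀ {n k occ a s x} → parkSpot n k occ a ≡ just s →
  1 ≤ x → a ∸ k ≤ x → x ≤ a → x ∉ occ → x ≤ s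
parkSpot-backward {n} {k} {occ} {a} parked 1≤x a∸k≤x x≤a x∉occ
  with firstFree occ (a ∷ backSpots a k) in back | trans (sym (parkSpot-split n k occ a)) parked
... | just _ | refl
  with firstFree-first occ (backSpots-descending a k) back (∈-backward⁺ {a} {k} 1≤x a∸k≤x x≤a) x∉occ
...   | inj₁ refl = ≤-refl
...   | inj₂ x≤s = x≤s
parkSpot-backward {n} {k} {occ} {a} parked 1≤x a∸k≤x x≤a x∉occ | nothing | _ =
  ⊥-elim (x∉occ (All.lookup (firstFree-nothing occ _ back) (∈-backward⁺ {a} {k} 1≤x a∸k≤x x≤a)))

parkSpot-forward : ∀ {n k occ a s x} → parkSpot n k occ a ≡ just s → a < s →
  1 ≤ x → a ∸ k ≤ x → x < s → x ∈ occ
parkSpot-forward {n} {k} {occ} {a} {s} {x} parked a<s 1≤x a∸k≤x x<s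
  with firstFree occ (a ∷ backSpots a k) in back | trans (sym (parkSpot-split n k occ a)) parked
... | just _ | refl =
  ⊥-elim (<⇒≱ a<s (proj₂ (∈-backward⁻ {a} {k} (proj₁ (firstFree-just occ (a ∷ backSpots a k) back)))))
... | nothing | forward with x ≤? a
...   | yes x≤a = All.lookup (firstFree-nothing occ _ back) (∈-backward⁺ {a} {k} 1≤x a∸k≤x x≤a)
...   | no x≰a = decidable-stable (x ∈? occ) λ x∉occ →
  case firstFree-first occ (AllPairs.map <⇒≤ (forwardSpots-ascending n a)) forward x∈ x∉occ of λ where
    (inj₁ refl) → <-irrefl refl x<s
    (inj₂ s≤x) → <⇒≱ x<s s≤x
  where
  x∈ : x ∈ forwardSpots n a
  x∈ = ∈-forwardSpots⁺ {n} {a} (≰⇒> x≰a)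
         (<⇒≤ (<-≤-trans x<s (proj₂ (∈-forwardSpots⁻ {n} {a} (proj₁ (firstFree-just occ _ forward))))))

-- Counting preferences

count≥ : ℕ → List ℕ → ℕ
count≥ j xs = length (filter (j ≤?_) xs)

count≡ : ℕ → List ℕ → ℕ
count≡ i xs = length (filter (_≟ i) xs)

count≥-++ : ∀ j xs ys → count≥ j (xs ++ ys) ≡ count≥ j xs + count≥ j ys
count≥-++ j xs ys = trans (cong length (filter-++ (j ≤?_) xs ys)) (length-++ (filter (j ≤?_) xs))

count≥-↭ : ∀ j {xs ys} → xs ↭ ys → count≥ j xs ≡ count≥ j ys
count≥-↭ j xs↭ys = ↭-length (filter-↭ (j ≤?_) xs↭ys)

count≥-accept : ∀ {j x} xs → j ≤ x → count≥ j (x ∷ xs) ≡ suc (count≥ j xs)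
count≥-accept {j} xs j≤x = cong length (filter-accept (j ≤?_) {xs = xs} j≤x)

count≥-reject : ∀ {j x} xs → x < j → count≥ j (x ∷ xs) ≡ count≥ j xs
count≥-reject {j} xs x<j = cong length (filter-reject (j ≤?_) {xs = xs} (<⇒≱ x<j))

count≥-all : ∀ {j xs} → All (j ≤_) xs → count≥ j xs ≡ length xs
count≥-all {j} all = cong length (filter-all (j ≤?_) all)

count≥-none : ∀ {j xs} → All (_< j) xs → count≥ j xs ≡ 0
count≥-none {j} none = cong length (filter-none (j ≤?_) (All.map <⇒≱ none))

count≥-≤-length : ∀ j xs → count≥ j xs ≤ length xs
count≥-≤-length j = length-filter (j ≤?_)

count≥-antitone : ∀ {i j} xs → i ≤ j → count≥ j xs ≤ count≥ i xs
count≥-antitone [] i≤j = z≤n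
count≥-antitone {i} {j} (x ∷ xs) i≤j with i ≤? x | j ≤? x
... | no i≰x | _
  rewrite count≥-reject xs (≰⇒> i≰x) | count≥-reject xs (<-≤-trans (≰⇒> i≰x) i≤j) =
  count≥-antitone xs i≤j
... | yes i≤x | no j≰x
  rewrite count≥-accept xs i≤x | count≥-reject xs (≰⇒> j≰x) = m≤n⇒m≤1+n (count≥-antitone xs i≤j)
... | yes i≤x | yes j≤x
  rewrite count≥-accept xs i≤x | count≥-accept xs j≤x = s≤s (count≥-antitone xs i≤j)

count≥-split : ∀ j xs → count≥ j xs ≡ count≡ j xs + count≥ (suc j) xs
count≥-split j [] = refl
count≥-split j (x ∷ xs) with <-cmp x j
... | tri< x<j x≢j _
  rewrite count≥-reject xs x<j | count≥-reject xs (m<n⇒m<1+n x<j)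
        | filter-reject (_≟ j) {xs = xs} x≢j = count≥-split j xs
... | tri≈ _ refl _
  rewrite count≥-accept xs (≤-refl {x}) | count≥-reject xs (n<1+n x)
        | filter-accept (_≟ x) {xs = xs} refl = cong suc (count≥-split x xs)
... | tri> _ x≢j j<x
  rewrite count≥-accept xs (<⇒≤ j<x) | count≥-accept xs j<x
        | filter-reject (_≟ j) {xs = xs} x≢j =
  trans (cong suc (count≥-split j xs)) (sym (+-suc (count≡ j xs) (count≥ (suc j) xs)))

sum-count≡ : ∀ j m xs →
  lsum (applyUpTo (λ t → count≡ (j + t) xs) m) + count≥ (j + m) xs ≡ count≥ j xs
sum-count≡ j zero xs = cong (λ i → count≥ i xs) (+-identityʳ j)
sum-count≡ j (suc m) xs = begin
  lsum (applyUpTo f (suc m)) + count≥ (j + suc m) xs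
    ≡⟨ cong₂ _+_ (cong lsum (sym (applyUpTo-∷ʳ f m))) (cong (λ i → count≥ i xs) (+-suc j m)) ⟩
  lsum (applyUpTo f m ++ [ f m ]) + count≥ (suc (j + m)) xs
    ≡⟨ cong (_+ count≥ (suc (j + m)) xs) (sum-++ (applyUpTo f m) [ f m ]) ⟩
  lsum (applyUpTo f m) + (f m + 0) + count≥ (suc (j + m)) xs
    ≡⟨ cong (λ c → lsum (applyUpTo f m) + c + count≥ (suc (j + m)) xs) (+-identityʳ (f m)) ⟩
  lsum (applyUpTo f m) + f m + count≥ (suc (j + m)) xs
    ≡⟨ +-assoc (lsum (applyUpTo f m)) (f m) _ ⟩
  lsum (applyUpTo f m) + (f m + count≥ (suc (j + m)) xs)
    ≡⟨ cong (lsum (applyUpTo f m) +_) (sym (count≥-split (j + m) xs)) ⟩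
  lsum (applyUpTo f m) + count≥ (j + m) xs
    ≡⟨ sum-count≡ j m xs ⟩
  count≥ j xs ∎
  where
  open ≡-Reasoning
  f = λ t → count≡ (j + t) xs

tailSum≡count≥ : ∀ {n α} → InPP n α → ∀ j → tailSum n α j ≡ count≥ j (tabulate α)
tailSum≡count≥ {n} {α} pp j = begin
  tailSum n α j                ≡⟨ cong lsum (map-upTo (λ t → count≡ (j + t) (tabulate α)) m) ⟩
  Σcount≡                      ≡⟨ sym (+-identityʳ Σcount≡) ⟩
  Σcount≡ + 0                  ≡⟨ cong (Σcount≡ +_) (sym (count≥-none below)) ⟩
  Σcount≡ + count≥ (j + m) (tabulate α) ≡⟨ sum-count≡ j m (tabulate α) ⟩
  count≥ j (tabulate α)        ∎
  where
  open ≡-Reasoning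
  m = suc n ∸ j
  Σcount≡ = lsum (applyUpTo (λ t → count≡ (j + t) (tabulate α)) m)
  below : All (_< j + m) (tabulate α)
  below = Allₚ.tabulate⁺ (λ i → ≤-trans (s≤s (proj₂ (pp i))) (m≤n+m∸n (suc n) j))

1≤m-n⇔n<m : ∀ m n → (ℤ.+ 1 ℤ.≤ ℤ.+ m ℤ.- ℤ.+ n) ⇔ n < m
1≤m-n⇔n<m m n rewrite ℤₚ.m-n≡m⊖n m n = mk⇔ to from
  where
  to : ℤ.+ 1 ℤ.≤ m ℤ.⊖ n → n < m
  to 1≤m⊖n with n ≤? m
  ... | yes n≤m = m∸n≢0⇒n<m λ m∸n≡0 →
    1+n≰n (ℤₚ.drop‿+≤+ (subst (ℤ.+ 1 ℤ.≤_) (trans (ℤₚ.⊖-≥ n≤m) (cong ℤ.+_ m∸n≡0)) 1≤m⊖n))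
  ... | no n≰m = ⊥-elim (1+n≰n (ℤₚ.drop‿+≤+
    (ℤₚ.≤-trans (subst (ℤ.+ 1 ℤ.≤_) (ℤₚ.⊖-< (≰⇒> n≰m)) 1≤m⊖n) (ℤₚ.neg-≤-pos {n = 0}))))
  from : n < m → ℤ.+ 1 ℤ.≤ m ℤ.⊖ n
  from n<m = subst (ℤ.+ 1 ℤ.≤_) (sym (ℤₚ.⊖-≥ (<⇒≤ n<m))) (ℤ.+≤+ (m<n⇒0<n∸m n<m))

Crowded : ℕ → List ℕ → ℕ → Set
Crowded n cars j = suc n ∸ j < count≥ j cars

InU⇔crowded : ∀ {n α} → InPP n α → ∀ j → InU n α j ⇔ ((1 ≤ j × j ≤ n) × Crowded n (tabulate α) j)
InU⇔crowded {n} {α} pp j = mk⇔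
  (λ (range , 1≤u) → range , subst (suc n ∸ j <_) tailSum≡ (Equivalence.to (1≤m-n⇔n<m _ _) 1≤u))
  (λ (range , crowded) → range , Equivalence.from (1≤m-n⇔n<m _ _) (subst (suc n ∸ j <_) (sym tailSum≡) crowded))
  where tailSum≡ = tailSum≡count≥ pp j

¬InU⇒count≥≤ : ∀ {n α} → InPP n α → ∀ {j} → j ≤ n → ¬ InU n α j →
  count≥ j (tabulate α) ≤ suc n ∸ j
¬InU⇒count≥≤ {n} {α} pp {zero} _ _ =
  m≤n⇒m≤1+n (subst (count≥ 0 (tabulate α) ≤_) (length-tabulate α) (count≥-≤-length 0 (tabulate α)))
¬InU⇒count≥≤ pp {suc j} j<n ¬U =
  ≮⇒≥ λ crowded → ¬U (Equivalence.from (InU⇔crowded pp (suc j)) ((s≤s z≤n , j<n) , crowded))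

count≥-tabulate : ∀ j {n} (f : Fin n → ℕ) → count≥ j (tabulate f) ≡ sum (λ i → count≥ j [ f i ])
count≥-tabulate j {zero} f = refl
count≥-tabulate j {suc n} f =
  trans (count≥-++ j [ f Fin.zero ] (tabulate (f ∘ Fin.suc)))
        (cong (count≥ j [ f Fin.zero ] +_) (count≥-tabulate j (f ∘ Fin.suc)))

count≥-permute : ∀ j {n} (f : Fin n → ℕ) (σ : Permutation′ n) →
  count≥ j (tabulate (λ i → f (σ ⟨$⟩ʳ i))) ≡ count≥ j (tabulate f)
count≥-permute j f σ = begin
  count≥ j (tabulate (λ i → f (σ ⟨$⟩ʳ i)))  ≡⟨ count≥-tabulate j (λ i → f (σ ⟨$⟩ʳ i)) ⟩
  sum (λ i → count≥ j [ f (σ ⟨$⟩ʳ i) ])     ≡⟨ sym (sum-permute (λ i → count≥ j [ f i ]) σ) ⟩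
  sum (λ i → count≥ j [ f i ])               ≡⟨ sym (count≥-tabulate j f) ⟩
  count≥ j (tabulate f)                      ∎
  where open ≡-Reasoning

InU? : ∀ n α → Decidable (InU n α)
InU? n α j = ((1 ≤? j) ×-dec (j ≤? n)) ×-dec (ℤ.+ 1 ℤₚ.≤? u n α j)

-- A jammed arrangement

-- A history lists the parked cars as (preference , spot) pairs.
spots : List (ℕ × ℕ) → List ℕ
spots = map proj₂

prefs : List (ℕ × ℕ) → List ℕ
prefs = map proj₁

count≥-prefs : ∀ j parked → count≥ j (prefs parked) ≡ length (filter (λ c → j ≤? proj₁ c) parked)
count≥-prefs j [] = refl
count≥-prefs j ((b , s) ∷ parked) with j ≤? b
... | yes j≤b = trans (count≥-accept (prefs parked) j≤b) (trans (cong suc (count≥-prefs j parked))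
  (sym (cong length (filter-accept (λ c → j ≤? proj₁ c) {xs = parked} j≤b))))
... | no j≰b = trans (count≥-reject (prefs parked) (≰⇒> j≰b)) (trans (count≥-prefs j parked)
  (sym (cong length (filter-reject (λ c → j ≤? proj₁ c) {xs = parked} j≰b))))

NoGapBelow : ℕ → List ℕ → ℕ × ℕ → Set
NoGapBelow k occ (b , s) = b < s → ∀ {x} → 1 ≤ x → b ∸ k ≤ x → x < s → x ∈ occ

record Jam (n k : ℕ) (cars : List ℕ) : Set where
  field
    parked : List (ℕ × ℕ)
    blocked : ℕ
    waiting : List ℕ
    noGaps : All (NoGapBelow k (spots parked)) parked
    blocked≤n : blocked ≤ n
    stuck : parkSpot n k (spots parked) blocked ≡ nothing
    conserved : prefs parked ++ blocked ∷ waiting ↭ cars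

runAll-false⇒jam : ∀ {n k cars} history queue → prefs history ++ queue ↭ cars →
  All (NoGapBelow k (spots history)) history → All (_≤ n) queue →
  runAll n k (spots history) queue ≡ false → Jam n k cars
runAll-false⇒jam {n} {k} history (a ∷ queue) conserved noGaps (a≤n ∷ queue≤n) fails
  with parkSpot n k (spots history) a in parks
... | nothing = record
  { parked = history ; blocked = a ; waiting = queue ; noGaps = noGaps
  ; blocked≤n = a≤n ; stuck = parks ; conserved = conserved }
... | just s = runAll-false⇒jam ((a , s) ∷ history) queue
  (↭-trans (↭-sym (shift a (prefs history) queue)) conserved)
  ((λ a<s {x} 1≤x a∸k≤x x<s → there (parkSpot-forward {n} {k} parks a<s 1≤x a∸k≤x x<s))
   ∷ All.map (λ noGap b<s {x} 1≤x b∸k≤x x<s → there (noGap b<s 1≤x b∸k≤x x<s)) noGaps)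
  queue≤n fails

stuck⇒crowdedWindow : ∀ {n k parked a} → All (NoGapBelow k (spots parked)) parked → a ≤ n →
  parkSpot n k (spots parked) a ≡ nothing → length parked < n →
  ∃ λ f → 1 ≤ f × f + k < a × (∀ {i} → f ≤ i → i ≤ f + k → Crowded n (a ∷ prefs parked) (suc i))
stuck⇒crowdedWindow {n} {k} {parked} {a} noGaps a≤n stuck fewer
  with lastCounterexample (_∈? spots parked) n
... | inj₁ allTaken = ⊥-elim (<⇒≱ fewer (begin
  n                          ≡⟨ sym (length-forwardSpots n 0) ⟩
  length (forwardSpots n 0)  ≤⟨ unique-⊆⇒length≤ (forwardSpots-unique n 0) taken ⟩
  length (spots parked)      ≡⟨ length-map proj₂ parked ⟩
  length parked              ∎))
  where
  open ≤-Reasoning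
  taken : forwardSpots n 0 ⊆ spots parked
  taken x∈ = let 0<x , x≤n = ∈-forwardSpots⁻ {n} {0} x∈ in allTaken 0<x x≤n
... | inj₂ (f , 1≤f , f≤n , f∉ , aboveTaken) = f , 1≤f , f+k<a , crowded
  where
  f+k<a : f + k < a
  f+k<a = ≰⇒> λ a≤f+k →
    f∉ (parkSpot-nothing {n} {k} stuck 1≤f (m≤n+o⇒m∸n≤o a k (subst (a ≤_) (+-comm f k) a≤f+k)) f≤n)

  prefersAbove : ∀ {i} → f ≤ i → i ≤ f + k → ∀ {c} → c ∈ parked → suc i ≤ proj₂ c → suc i ≤ proj₁ c
  prefersAbove {i} f≤i i≤f+k {b , s} c∈ i<s = ≮⇒≥ λ b<1+i → f∉
    (All.lookup noGaps c∈ (<-≤-trans b<1+i i<s) 1≤f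
      (m≤n+o⇒m∸n≤o b k (subst (b ≤_) (+-comm f k) (≤-trans (s≤s⁻¹ b<1+i) i≤f+k)))
      (≤-<-trans f≤i i<s))

  crowded : ∀ {i} → f ≤ i → i ≤ f + k → Crowded n (a ∷ prefs parked) (suc i)
  crowded {i} f≤i i≤f+k = begin-strict
    n ∸ i                                     ≡⟨ sym (length-forwardSpots n i) ⟩
    length (forwardSpots n i)                 ≤⟨ unique-⊆⇒length≤ (forwardSpots-unique n i) taken ⟩
    length (spots (filter atLeast parked))    ≡⟨ length-map proj₂ (filter atLeast parked) ⟩
    length (filter atLeast parked)            ≡⟨ sym (count≥-prefs (suc i) parked) ⟩
    count≥ (suc i) (prefs parked)             <⟨ n<1+n _ ⟩
    suc (count≥ (suc i) (prefs parked))       ≡⟨ sym (count≥-accept (prefs parked) (≤-trans (s≤s i≤f+k) f+k<a)) ⟩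
    count≥ (suc i) (a ∷ prefs parked)         ∎
    where
    open ≤-Reasoning
    atLeast = λ (c : ℕ × ℕ) → suc i ≤? proj₁ c
    taken : forwardSpots n i ⊆ spots (filter atLeast parked)
    taken x∈ with i<x , x≤n ← ∈-forwardSpots⁻ {n} {i} x∈
      with c , c∈ , refl ← ∈-map⁻ proj₂ (aboveTaken (≤-<-trans f≤i i<x) x≤n) =
      ∈-map⁺ proj₂ (∈-filter⁺ atLeast c∈ (prefersAbove f≤i i≤f+k c∈ i<x))

jam⇒windowInU : ∀ {n k α} → InPP n α → (σ : Permutation′ n) → Jam n k (tabulate (λ i → α (σ ⟨$⟩ʳ i))) →
  ∃ λ f → IsIntervalIn (InU n α) (suc f) (suc (f + k))
jam⇒windowInU {n} {k} {α} pp σ jam = f , s≤s (m≤m+n f k) , inside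
  where
  open Jam jam
  cars = tabulate (λ i → α (σ ⟨$⟩ʳ i))

  fewer : length parked < n
  fewer = begin-strict
    length parked                                          ≡⟨ sym (length-map proj₁ parked) ⟩
    length (prefs parked)                                  <⟨ m<m+n (length (prefs parked)) z<s ⟩
    length (prefs parked) + length (blocked ∷ waiting)     ≡⟨ sym (length-++ (prefs parked)) ⟩
    length (prefs parked ++ blocked ∷ waiting)             ≡⟨ ↭-length conserved ⟩
    length cars                                            ≡⟨ length-tabulate _ ⟩
    n                                                      ∎
    where open ≤-Reasoning

  count≥-jammed≤ : ∀ j → count≥ j (blocked ∷ prefs parked) ≤ count≥ j (tabulate α)
  count≥-jammed≤ j = begin
    count≥ j (blocked ∷ prefs parked)                         ≤⟨ m≤m+n _ (count≥ j waiting) ⟩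
    count≥ j (blocked ∷ prefs parked) + count≥ j waiting      ≡⟨ sym (count≥-++ j (blocked ∷ prefs parked) waiting) ⟩
    count≥ j (blocked ∷ prefs parked ++ waiting)
      ≡⟨ count≥-↭ j (↭-trans (↭-sym (shift blocked (prefs parked) waiting)) conserved) ⟩
    count≥ j cars                                             ≡⟨ count≥-permute j α σ ⟩
    count≥ j (tabulate α)                                     ∎
    where open ≤-Reasoning

  window = stuck⇒crowdedWindow noGaps blocked≤n stuck fewer
  f = proj₁ window
  f+k<blocked = proj₁ (proj₂ (proj₂ window))
  crowded = proj₂ (proj₂ (proj₂ window))

  inside : ∀ j → suc f ≤ j → j ≤ suc (f + k) → InU n α j
  inside (suc i) (s≤s f≤i) (s≤s i≤f+k) = Equivalence.from (InU⇔crowded pp (suc i))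
    ((s≤s z≤n , ≤-trans (s≤s i≤f+k) (≤-trans f+k<blocked blocked≤n)) ,
     <-≤-trans (crowded f≤i i≤f+k) (count≥-jammed≤ (suc i)))

intervalSize-window : ∀ f k → intervalSize (suc f) (suc (f + k)) ≡ suc k
intervalSize-window f k = trans (cong (_∸ f) (sym (+-suc f k))) (m+n∸m≡n f (suc k))

shortMaximalIntervals⇒allPark : ∀ {n k α} → InPP n α →
  ((p q : ℕ) → IsMaximalIntervalIn (InU n α) p q → intervalSize p q ≤ k) →
  (σ : Permutation′ n) → InPF n k (λ i → α (σ ⟨$⟩ʳ i))
shortMaximalIntervals⇒allPark {n} {k} {α} pp short σ
  with runAll n k [] (tabulate (λ i → α (σ ⟨$⟩ʳ i))) in outcome
... | true = refl
... | false
  with f , window ← jam⇒windowInU pp σ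
         (runAll-false⇒jam [] _ ↭-refl [] (Allₚ.tabulate⁺ (λ i → proj₂ (pp (σ ⟨$⟩ʳ i)))) outcome)
  with p , q , maximal , window≤ ← extendToMaximal (InU? n α) (λ ()) (λ inU → proj₂ (proj₁ inU)) window =
  ⊥-elim (<⇒≱ (subst (_≤ intervalSize p q) (intervalSize-window f k) window≤) (short p q maximal))

-- A front-loaded arrangement

-- Sorting by this key lists the cars preferring a spot ≥ p first, in increasing order.
frontKey : ℕ → ℕ → ℕ → ℕ
frontKey n p x with p ≤? x
... | yes _ = x
... | no _ = suc (n + x)

FrontLoaded : ℕ → ℕ → ℕ → Set
FrontLoaded p y w = p ≤ w → p ≤ y × y ≤ w

frontKey-ordered : ∀ {n p y w} → y ≤ n → w ≤ n → frontKey n p y ≤ frontKey n p w → FrontLoaded p y w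
frontKey-ordered {n} {p} {y} {w} y≤n w≤n key≤ p≤w with p ≤? y | p ≤? w
... | yes p≤y | yes _ = p≤y , key≤
... | _ | no p≰w = ⊥-elim (p≰w p≤w)
... | no _ | yes _ = ⊥-elim (<⇒≱ (s≤s (≤-trans w≤n (m≤m+n n y))) key≤)

module FrontLoadedRun (n k P₀ : ℕ) (cars : List ℕ)
  (sparse : count≥ P₀ cars ≤ suc n ∸ P₀)
  (crowded : ∀ {i} → P₀ ≤ i → i ≤ P₀ + k → Crowded n cars (suc i)) where

  p : ℕ
  p = suc P₀

  record Invariant (history : List (ℕ × ℕ)) (rest : List ℕ) : Set where
    field
      conserved : prefs history ++ rest ↭ cars
      distinct : Unique (spots history)
      placed : All (λ c → p ≤ proj₁ c × p ≤ proj₂ c × proj₂ c ≤ n) history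
      ordered : All (λ y → All (FrontLoaded p y) rest) (prefs history)
      sorted : AllPairs (FrontLoaded p) rest
      rest≤n : All (_≤ n) rest

  module _ {history rest} (inv : Invariant history rest) where
    open Invariant inv

    count≥p-history : count≥ p (prefs history) ≡ length history
    count≥p-history = trans (count≥-all (Allₚ.map⁺ (All.map proj₁ placed))) (length-map proj₁ history)

    length-history≤n∸P₀ : length history ≤ n ∸ P₀
    length-history≤n∸P₀ = begin
      length history             ≡⟨ sym (length-map proj₂ history) ⟩
      length (spots history)     ≤⟨ unique-⊆⇒length≤ distinct inside ⟩
      length (forwardSpots n P₀) ≡⟨ length-forwardSpots n P₀ ⟩
      n ∸ P₀                     ∎
      where
      open ≤-Reasoning
      inside : spots history ⊆ forwardSpots n P₀
      inside s∈ with c , c∈ , refl ← ∈-map⁻ proj₂ s∈ =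
        let _ , p≤s , s≤n = All.lookup placed c∈ in ∈-forwardSpots⁺ {n} {P₀} p≤s s≤n

  noFrontCarLeft⇒⊥ : ∀ {history rest} → Invariant history rest → All (_< p) rest → ⊥
  noFrontCarLeft⇒⊥ {history} {rest} inv small = <⇒≱ (crowded ≤-refl (m≤m+n P₀ k)) (begin
    count≥ p cars                                    ≡⟨ sym (count≥-↭ p conserved) ⟩
    count≥ p (prefs history ++ rest)                 ≡⟨ count≥-++ p (prefs history) rest ⟩
    count≥ p (prefs history) + count≥ p rest         ≡⟨ cong₂ _+_ (count≥p-history inv) (count≥-none small) ⟩
    length history + 0                               ≡⟨ +-identityʳ _ ⟩
    length history                                   ≤⟨ length-history≤n∸P₀ inv ⟩
    n ∸ P₀                                           ∎)
    where
    open Invariant inv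
    open ≤-Reasoning

  -- The cars parked so far prefer spots in [p, z]; as p − 1 ∉ U and z + 1 ∈ U,
  -- there are fewer of them than spots in [p, z].
  length-history<z∸P₀ : ∀ {history z rest} → Invariant history (z ∷ rest) → p ≤ z → z ≤ P₀ + k →
    length history < z ∸ P₀
  length-history<z∸P₀ {history} {z} {rest} inv p≤z z≤P₀+k =
    +-cancelʳ-≤ (suc (n ∸ z)) (suc (length history)) (z ∸ P₀) (begin
      suc (length history) + suc (n ∸ z)        ≤⟨ +-monoʳ-≤ (suc (length history)) crowded-rest ⟩
      suc (length history) + count≥ p rest      ≡⟨ sym (+-suc (length history) (count≥ p rest)) ⟩
      length history + suc (count≥ p rest)
        ≡⟨ cong₂ _+_ (sym (count≥p-history inv)) (sym (count≥-accept rest p≤z)) ⟩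
      count≥ p (prefs history) + count≥ p (z ∷ rest)  ≡⟨ sym (count≥-++ p (prefs history) (z ∷ rest)) ⟩
      count≥ p (prefs history ++ z ∷ rest)      ≡⟨ count≥-↭ p conserved ⟩
      count≥ p cars                             ≤⟨ count≥-antitone cars (n≤1+n P₀) ⟩
      count≥ P₀ cars                            ≤⟨ sparse ⟩
      suc n ∸ P₀                                ≡⟨ +-∸-assoc 1 P₀≤n ⟩
      suc (n ∸ P₀)                              ≡⟨ cong suc (∸-split (<⇒≤ p≤z) z≤n′) ⟩
      suc ((n ∸ z) + (z ∸ P₀))                  ≡⟨ cong suc (+-comm (n ∸ z) (z ∸ P₀)) ⟩
      suc ((z ∸ P₀) + (n ∸ z))                  ≡⟨ sym (+-suc (z ∸ P₀) (n ∸ z)) ⟩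
      (z ∸ P₀) + suc (n ∸ z)                    ∎)
    where
    open Invariant inv
    open ≤-Reasoning
    z≤n′ = All.head rest≤n
    P₀≤n = ≤-trans (<⇒≤ p≤z) z≤n′
    history≤z : All (_< suc z) (prefs history)
    history≤z = All.map (λ front → s≤s (proj₂ (All.head front p≤z))) ordered
    crowded-rest : suc (n ∸ z) ≤ count≥ p rest
    crowded-rest = begin
      suc (n ∸ z)                                          ≤⟨ crowded (<⇒≤ p≤z) z≤P₀+k ⟩
      count≥ (suc z) cars                                  ≡⟨ sym (count≥-↭ (suc z) conserved) ⟩
      count≥ (suc z) (prefs history ++ z ∷ rest)           ≡⟨ count≥-++ (suc z) (prefs history) (z ∷ rest) ⟩
      count≥ (suc z) (prefs history) + count≥ (suc z) (z ∷ rest)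
        ≡⟨ cong₂ _+_ (count≥-none history≤z) (count≥-reject rest (n<1+n z)) ⟩
      count≥ (suc z) rest                                  ≤⟨ count≥-antitone rest (s≤s (<⇒≤ p≤z)) ⟩
      count≥ p rest                                        ∎

  -- Either z's backward range stays above P₀, or it covers all of [p, z], which still has a free spot.
  parksAbove : ∀ {history z rest s} → Invariant history (z ∷ rest) → p ≤ z →
    parkSpot n k (spots history) z ≡ just s → p ≤ s
  parksAbove {history} {z} {rest} {s} inv p≤z parks with P₀ + k <? z
  ... | yes P₀+k<z = ≤-trans (m+n≤o⇒m≤o∸n p P₀+k<z) (proj₁ (parkSpot-range {n} {k} parks (All.head rest≤n)))
    where open Invariant inv
  ... | no P₀+k≮z with All.all? (_∈? spots history) (forwardSpots z P₀)
  ...   | yes allTaken = ⊥-elim (<⇒≱ (length-history<z∸P₀ inv p≤z (≮⇒≥ P₀+k≮z)) (begin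
    z ∸ P₀                     ≡⟨ sym (length-forwardSpots z P₀) ⟩
    length (forwardSpots z P₀) ≤⟨ unique-⊆⇒length≤ (forwardSpots-unique z P₀) (All.lookup allTaken) ⟩
    length (spots history)     ≡⟨ length-map proj₂ history ⟩
    length history             ∎))
    where open ≤-Reasoning
  ...   | no ¬allTaken with x , x∈ , x∉ ← find (Allₚ.¬All⇒Any¬ (_∈? spots history) _ ¬allTaken) =
    let P₀<x , x≤z = ∈-forwardSpots⁻ {z} {P₀} x∈ in
    ≤-trans P₀<x (parkSpot-backward {n} {k} parks (≤-trans (s≤s z≤n) P₀<x)
      (≤-trans (m≤n+o⇒m∸n≤o z k (subst (z ≤_) (+-comm P₀ k) (≮⇒≥ P₀+k≮z))) (<⇒≤ P₀<x)) x≤z x∉)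

  parkFrontCar : ∀ {history z rest s} → Invariant history (z ∷ rest) → p ≤ z →
    parkSpot n k (spots history) z ≡ just s → Invariant ((z , s) ∷ history) rest
  parkFrontCar {history} {z} {rest} {s} inv p≤z parks = record
    { conserved = ↭-trans (↭-sym (shift z (prefs history) rest)) conserved
    ; distinct = Allₚ.¬Any⇒All¬ (spots history) (parkSpot-free {n} {k} parks) ∷ distinct
    ; placed = (p≤z , parksAbove inv p≤z parks , proj₂ (parkSpot-range {n} {k} parks (All.head rest≤n))) ∷ placed
    ; ordered = AllPairs.head sorted ∷ All.map All.tail ordered
    ; sorted = AllPairs.tail sorted
    ; rest≤n = All.tail rest≤n
    }
    where open Invariant inv

  cannotAllPark : ∀ {history rest} → Invariant history rest → runAll n k (spots history) rest ≡ true → ⊥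
  cannotAllPark {rest = []} inv _ = noFrontCarLeft⇒⊥ inv []
  cannotAllPark {history} {z ∷ rest} inv parksAll with p ≤? z
  ... | no p≰z = noFrontCarLeft⇒⊥ inv (≰⇒> p≰z ∷ All.map (λ front → ≰⇒> (p≰z ∘ proj₁ ∘ front)) zFirst)
    where zFirst = AllPairs.head (Invariant.sorted inv)
  ... | yes p≤z with parkSpot n k (spots history) z in parks | parksAll
  ...   | just s | parksRest = cannotAllPark (parkFrontCar inv p≤z parks) parksRest
  ...   | nothing | ()

allPark⇒shortMaximalIntervals : ∀ {n k α} → InPP n α →
  ((σ : Permutation′ n) → InPF n k (λ i → α (σ ⟨$⟩ʳ i))) →
  (p q : ℕ) → IsMaximalIntervalIn (InU n α) p q → intervalSize p q ≤ k
allPark⇒shortMaximalIntervals pp allPark zero q ((0≤q , inside) , _) =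
  ⊥-elim (1+n≰n (proj₁ (proj₁ (inside 0 ≤-refl 0≤q))))
allPark⇒shortMaximalIntervals {n} {k} {α} pp allPark (suc P₀) q maximal@((p≤q , inside) , _)
  with k <? intervalSize (suc P₀) q
... | no k≮size = ≮⇒≥ k≮size
... | yes k<size = ⊥-elim (cannotAllPark initial (allPark σ))
  where
  p≤n : suc P₀ ≤ n
  p≤n = proj₂ (proj₁ (inside (suc P₀) ≤-refl p≤q))
  sorting = sortingPermutation (λ i → frontKey n (suc P₀) (α i))
  σ = proj₁ sorting
  cars = tabulate (λ i → α (σ ⟨$⟩ʳ i))

  sparse : count≥ P₀ cars ≤ suc n ∸ P₀
  sparse = subst (_≤ suc n ∸ P₀) (sym (count≥-permute P₀ α σ))
    (¬InU⇒count≥≤ pp (<⇒≤ p≤n) (maximal⇒¬below maximal))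

  crowded : ∀ {i} → P₀ ≤ i → i ≤ P₀ + k → Crowded n cars (suc i)
  crowded {i} P₀≤i i≤P₀+k = subst (n ∸ i <_) (sym (count≥-permute (suc i) α σ))
    (proj₂ (Equivalence.to (InU⇔crowded pp (suc i)) (inside (suc i) (s≤s P₀≤i) (≤-trans (s≤s i≤P₀+k) P₀+k<q))))
    where
    P₀+k<q : suc (P₀ + k) ≤ q
    P₀+k<q = subst (_≤ q) (cong suc (+-comm k P₀)) (m≤o∸n⇒m+n≤o (suc k) (≤-trans (n≤1+n P₀) p≤q) k<size)

  open FrontLoadedRun n k P₀ cars sparse crowded

  bound : ∀ i → α (σ ⟨$⟩ʳ i) ≤ n
  bound i = proj₂ (pp (σ ⟨$⟩ʳ i))

  initial : Invariant [] cars
  initial = record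
    { conserved = ↭-refl ; distinct = [] ; placed = [] ; ordered = []
    ; sorted = AllPairsₚ.tabulate⁺-< (λ i<j → frontKey-ordered (bound _) (bound _) (proj₂ sorting (<⇒≤ i<j)))
    ; rest≤n = Allₚ.tabulate⁺ bound
    }

mainTheorem7 : (n k : ℕ) (α : Fin n → ℕ) → InPP n α → 1 ≤ k →
    (((p q : ℕ) → IsMaximalIntervalIn (InU n α) p q → intervalSize p q ≤ k)
      ⇔ ((σ : Permutation′ n) → InPF n k (λ i → α (σ ⟨$⟩ʳ i))))
mainTheorem7 n k α pp _ = mk⇔ (shortMaximalIntervals⇒allPark pp) (allPark⇒shortMaximalIntervals pp)
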